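{- Let $T$ be a set of rooted binary phylogenetic trees, each on a subset of $X$. If $s=((x_1,y_1),\dots,(x_r,y_r),(x_{r+1},-))$ is a tree-child sequence for $T$ and $(a,b)\in T$, then there is an $i$ such that $(x_i,y_i)=(a,b)$ or $(x_i,y_i)=(b,a)$.
   Context: For a tree $\mathcal{T}$ and leaf $x$, $\mathcal{T}\setminus\{x\}$ deletes $x$ and suppresses vertices of in- and out-degree 1. $(a,b)\in\mathcal{T}$ means $a,b$ are leaves with a common parent in $\mathcal{T}$; $(a,b)\in T$ means $(a,b)\in\mathcal{T}$ for some $\mathcal{T}\in T$. A generalized cherry picking sequence on $X$ is $s=((x_1,y_1),\dots,(x_r,y_r),(x_{r+1},-),\dots,(x_t,-))$ with all $x_i,y_i\in X$; it is full if $t>r$ and $\{x_1,\dots,x_t\}=X$. Applying $s$ to a tree $\mathcal{T}$: $\mathcal{T}^{(0)}=\mathcal{T}$, and for $j=1,\dots,r$, $\mathcal{T}^{(j)}=\mathcal{T}^{(j-1)}\setminus\{x_j\}$ if $(x_j,y_j)\in\mathcal{T}^{(j-1)}$, else $\mathcal{T}^{(j)}=\mathcal{T}^{(j-1)}$; $\mathcal{T}(s)=\mathcal{T}^{(r)}$. A full $s$ is a generalized cherry picking sequence for $T$ if each $\mathcal{T}(s)$, $\mathcal{T}\in T$, consists of a single leaf belonging to $\{x_{r+1},\dots,x_t\}$. A tree-child sequence for $T$ is such a sequence with $t=r+1$ and $y_j\ne x_i$ for all $1\le i<j\le r$. -}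

module Defs where

open import Data.Nat using (ℕ)
open import Data.Fin using (Fin; _<_)
open import Data.Product using (_×_; _,_; proj₁; proj₂; Σ; ∃)
open import Data.Sum using (_⊎_)
open import Data.Maybe using (Maybe; just; nothing)
open import Data.List using (List; []; _∷_; _++_; map; length; lookup)
open import Data.List.Membership.Propositional using (_∈_)
open import Data.List.Relation.Unary.Unique.Propositional using (Unique)
open import Relation.Binary.Definitions using (DecidableEquality)
open import Relation.Binary.PropositionalEquality using (_≡_; _≢_)
open import Relation.Nullary using (¬_; yes; no)

data Tree (X : Set) : Set where
  leaf : X → Tree X
  node : Tree X → Tree X → Tree X

leaves : {X : Set} → Tree X → List X
leaves (leaf x)   = x ∷ []
leaves (node l r) = leaves l ++ leaves r

IsPhylo : {X : Set} → Tree X → Set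
IsPhylo t = Unique (leaves t)

data Cherry {X : Set} (a b : X) : Tree X → Set where
  here₁ : Cherry a b (node (leaf a) (leaf b))
  here₂ : Cherry a b (node (leaf b) (leaf a))
  inl   : ∀ {l r} → Cherry a b l → Cherry a b (node l r)
  inr   : ∀ {l r} → Cherry a b r → Cherry a b (node l r)

-- 𝒯 ∖ {x}: delete leaf x and suppress the resulting degree-2 vertex
-- (nothing = the empty tree).
delete : {X : Set} → DecidableEquality X → X → Tree X → Maybe (Tree X)
delete _≟_ x (leaf y) with x ≟ y
... | yes _ = nothing
... | no  _ = just (leaf y)
delete _≟_ x (node l r) with delete _≟_ x l | delete _≟_ x r
... | nothing | nothing = nothing
... | nothing | just r' = just r'
... | just l' | nothing = just l'
... | just l' | just r' = just (node l' r')

data Apply {X : Set} (_≟_ : DecidableEquality X) : List (X × X) → Tree X → Tree X → Set where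
  done : ∀ {t} → Apply _≟_ [] t t
  pick : ∀ {x y ps t t₁ t'} → Cherry x y t → delete _≟_ x t ≡ just t₁ →
         Apply _≟_ ps t₁ t' → Apply _≟_ ((x , y) ∷ ps) t t'
  skip : ∀ {x y ps t t'} → ¬ Cherry x y t →
         Apply _≟_ ps t t' → Apply _≟_ ((x , y) ∷ ps) t t'

record IsTreeChildSeq {X : Set} (_≟_ : DecidableEquality X)
         (T : List (Tree X)) (ps : List (X × X)) (z : X) : Set where
  field
    full      : ∀ (x : X) → x ∈ map proj₁ ps ⊎ x ≡ z
    reduces   : ∀ {t} → t ∈ T → Apply _≟_ ps t (leaf z)
    treeChild : ∀ (i j : Fin (length ps)) → i < j →
                proj₂ (lookup ps j) ≢ proj₁ (lookup ps i)

CherryOf : {X : Set} → X → X → List (Tree X) → Set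
CherryOf a b T = Σ _ λ t → t ∈ T × Cherry a b t

module Submission where

-- The argument is an invariant of cherry picking on a single tree t with
-- distinct leaf labels: a cherry (a , b) of t survives every step of the
-- sequence until a pair (a , b) or (b , a) is applied.  A step (x , y)
-- with x ∉ {a , b} deletes a leaf outside the cherry, so (a , b) is still a
-- cherry of the smaller tree; a step (x , y) with x ∈ {a , b} can only be
-- applied if (x , y) is a cherry, and since a leaf of a distinctly labelled
-- tree has at most one cherry partner, y is the other element of {a , b}.
-- Since the sequence reduces t to a single leaf, which has no cherry, the
-- cherry must have been picked.

open import Defs
open import Data.List using (List; []; _∷_; _++_; length; lookup)
open import Data.List.Membership.Propositional using (_∈_)
open import Data.List.Membership.Propositional.Properties using (∈-++⁺ˡ; ∈-++⁺ʳ; ∈-++⁻)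
open import Data.List.Relation.Binary.Disjoint.Propositional using (Disjoint)
open import Data.List.Relation.Unary.Any using (here; there)
open import Data.List.Relation.Unary.All as All using ()
open import Data.List.Relation.Unary.All.Properties using (++⁻ˡ)
open import Data.List.Relation.Unary.Unique.Propositional using (Unique; []; _∷_)
open import Data.Fin using (Fin; zero; suc)
open import Data.Maybe using (just; nothing)
open import Data.Product using (_×_; _,_; ∃)
open import Data.Sum using (_⊎_; inj₁; inj₂)
open import Data.Empty using (⊥-elim)
open import Relation.Nullary using (yes; no)
open import Relation.Binary.Definitions using (DecidableEquality)
open import Relation.Binary.PropositionalEquality using (_≡_; _≢_; refl; sym; trans)

module _ {X : Set} where

  unique-++⁻ : (xs ys : List X) → Unique (xs ++ ys) →
               Unique xs × Unique ys × Disjoint xs ys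
  unique-++⁻ []       ys u        = [] , u , λ ()
  unique-++⁻ (x ∷ xs) ys (x∉ ∷ u) with unique-++⁻ xs ys u
  ... | uxs , uys , disj = ++⁻ˡ xs x∉ ∷ uxs , uys , disj′
    where
    disj′ : Disjoint (x ∷ xs) ys
    disj′ (here refl , v∈ys) = All.lookup x∉ (∈-++⁺ʳ xs v∈ys) refl
    disj′ (there v∈xs , v∈ys) = disj (v∈xs , v∈ys)

  data Distinct : Tree X → Set where
    leaf : ∀ {x} → Distinct (leaf x)
    node : ∀ {l r} → Distinct l → Distinct r → Disjoint (leaves l) (leaves r) →
           Distinct (node l r)

  phylo⇒distinct : (t : Tree X) → IsPhylo t → Distinct t
  phylo⇒distinct (leaf x)   _ = leaf
  phylo⇒distinct (node l r) u with unique-++⁻ (leaves l) (leaves r) u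
  ... | ul , ur , disj = node (phylo⇒distinct l ul) (phylo⇒distinct r ur) disj

  cherry-sym : ∀ {a b} {t : Tree X} → Cherry a b t → Cherry b a t
  cherry-sym here₁   = here₂
  cherry-sym here₂   = here₁
  cherry-sym (inl c) = inl (cherry-sym c)
  cherry-sym (inr c) = inr (cherry-sym c)

  cherry-leaf : ∀ {a b} {t : Tree X} → Cherry a b t → a ∈ leaves t
  cherry-leaf here₁   = here refl
  cherry-leaf here₂   = there (here refl)
  cherry-leaf {t = node l r} (inl c) = ∈-++⁺ˡ (cherry-leaf c)
  cherry-leaf {t = node l r} (inr c) = ∈-++⁺ʳ (leaves l) (cherry-leaf c)

  cherry-partner-unique : ∀ {a b c} {t : Tree X} → Distinct t →
                          Cherry a b t → Cherry a c t → c ≡ b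
  cherry-partner-unique _ here₁ here₁ = refl
  cherry-partner-unique _ here₁ here₂ = refl
  cherry-partner-unique _ here₂ here₁ = refl
  cherry-partner-unique _ here₂ here₂ = refl
  cherry-partner-unique _ here₁ (inl ())
  cherry-partner-unique _ here₁ (inr ())
  cherry-partner-unique _ here₂ (inl ())
  cherry-partner-unique _ here₂ (inr ())
  cherry-partner-unique _ (inl ()) here₁
  cherry-partner-unique _ (inl ()) here₂
  cherry-partner-unique _ (inr ()) here₁
  cherry-partner-unique _ (inr ()) here₂
  cherry-partner-unique (node dl _ _) (inl c) (inl c′) = cherry-partner-unique dl c c′
  cherry-partner-unique (node _ dr _) (inr c) (inr c′) = cherry-partner-unique dr c c′
  cherry-partner-unique (node _ _ disj) (inl c) (inr c′) = ⊥-elim (disj (cherry-leaf c , cherry-leaf c′))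
  cherry-partner-unique (node _ _ disj) (inr c) (inl c′) = ⊥-elim (disj (cherry-leaf c′ , cherry-leaf c))

  Picks : List (X × X) → X → X → Set
  Picks ps a b = ∃ λ (i : Fin (length ps)) → lookup ps i ≡ (a , b) ⊎ lookup ps i ≡ (b , a)

  picked-later : ∀ {p ps a b} {P : Set} → Picks ps a b ⊎ P → Picks (p ∷ ps) a b ⊎ P
  picked-later (inj₁ (i , e)) = inj₁ (suc i , e)
  picked-later (inj₂ q)       = inj₂ q

  module _ (_≟_ : DecidableEquality X) where

    delete-other-leaf : ∀ {x y} → x ≢ y → delete _≟_ x (leaf y) ≡ just (leaf y)
    delete-other-leaf {x} {y} x≢y with x ≟ y
    ... | yes x≡y = ⊥-elim (x≢y x≡y)
    ... | no  _   = refl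

    delete-leaves : ∀ x (t : Tree X) {t′ y} → delete _≟_ x t ≡ just t′ →
                    y ∈ leaves t′ → y ∈ leaves t
    delete-leaves x (leaf z) eq y∈ with x ≟ z
    delete-leaves x (leaf z) () y∈   | yes _
    delete-leaves x (leaf z) refl y∈ | no _ = y∈
    delete-leaves x (node l r) eq y∈ with delete _≟_ x l in el | delete _≟_ x r in er
    delete-leaves x (node l r) () y∈   | nothing | nothing
    delete-leaves x (node l r) refl y∈ | nothing | just _ = ∈-++⁺ʳ (leaves l) (delete-leaves x r er y∈)
    delete-leaves x (node l r) refl y∈ | just _  | nothing = ∈-++⁺ˡ (delete-leaves x l el y∈)
    delete-leaves x (node l r) refl y∈ | just l′ | just _ with ∈-++⁻ (leaves l′) y∈
    ... | inj₁ y∈l′ = ∈-++⁺ˡ (delete-leaves x l el y∈l′)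
    ... | inj₂ y∈r′ = ∈-++⁺ʳ (leaves l) (delete-leaves x r er y∈r′)

    delete-distinct : ∀ x (t : Tree X) {t′} → delete _≟_ x t ≡ just t′ →
                      Distinct t → Distinct t′
    delete-distinct x (leaf z) eq d with x ≟ z
    delete-distinct x (leaf z) () d   | yes _
    delete-distinct x (leaf z) refl d | no _ = leaf
    delete-distinct x (node l r) eq d with delete _≟_ x l in el | delete _≟_ x r in er
    delete-distinct x (node l r) () _ | nothing | nothing
    delete-distinct x (node l r) refl (node _ dr _) | nothing | just _ = delete-distinct x r er dr
    delete-distinct x (node l r) refl (node dl _ _) | just _ | nothing = delete-distinct x l el dl
    delete-distinct x (node l r) refl (node dl dr disj) | just _ | just _ =
      node (delete-distinct x l el dl) (delete-distinct x r er dr)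
           (λ (v∈l′ , v∈r′) → disj (delete-leaves x l el v∈l′ , delete-leaves x r er v∈r′))

    delete-keeps-cherry : ∀ {a b x} (t : Tree X) → x ≢ a → x ≢ b → Cherry a b t →
                          ∃ λ t′ → delete _≟_ x t ≡ just t′ × Cherry a b t′
    delete-keeps-cherry _ x≢a x≢b here₁
      rewrite delete-other-leaf x≢a | delete-other-leaf x≢b = _ , refl , here₁
    delete-keeps-cherry _ x≢a x≢b here₂
      rewrite delete-other-leaf x≢a | delete-other-leaf x≢b = _ , refl , here₂
    delete-keeps-cherry {x = x} (node l r) x≢a x≢b (inl c)
      with delete-keeps-cherry l x≢a x≢b c
    ... | l′ , el , c′ rewrite el with delete _≟_ x r
    ...   | nothing = l′ , refl , c′
    ...   | just _  = _ , refl , inl c′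
    delete-keeps-cherry {x = x} (node l r) x≢a x≢b (inr c)
      with delete-keeps-cherry r x≢a x≢b c
    ... | r′ , er , c′ rewrite er with delete _≟_ x l
    ...   | nothing = r′ , refl , c′
    ...   | just _  = _ , refl , inr c′

    cherry-picked-or-kept : ∀ {a b} (ps : List (X × X)) {t t′ : Tree X} →
                            Distinct t → Apply _≟_ ps t t′ → Cherry a b t →
                            Picks ps a b ⊎ Cherry a b t′
    cherry-picked-or-kept [] _ done c = inj₂ c
    cherry-picked-or-kept (_ ∷ ps) d (skip _ rest) c =
      picked-later (cherry-picked-or-kept ps d rest c)
    cherry-picked-or-kept {a} {b} ((x , y) ∷ ps) {t} d (pick x∼y del rest) c
      with x ≟ a | x ≟ b
    ... | yes refl | _ rewrite cherry-partner-unique d c x∼y = inj₁ (zero , inj₁ refl)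
    ... | no _ | yes refl rewrite cherry-partner-unique d (cherry-sym c) x∼y = inj₁ (zero , inj₂ refl)
    ... | no x≢a | no x≢b with delete-keeps-cherry t x≢a x≢b c
    ...   | t₁ , del′ , c₁ with trans (sym del′) del
    ...     | refl = picked-later (cherry-picked-or-kept ps (delete-distinct x t del′ d) rest c₁)

mainTheorem11 : {X : Set} (_≟_ : DecidableEquality X) (T : List (Tree X)) →
    (∀ {t} → t ∈ T → IsPhylo t) →
    (ps : List (X × X)) (z : X) → IsTreeChildSeq _≟_ T ps z →
    (a b : X) → CherryOf a b T →
    ∃ λ (i : Fin (length ps)) → lookup ps i ≡ (a , b) ⊎ lookup ps i ≡ (b , a)
mainTheorem11 _≟_ T phylo ps z seq a b (t , t∈T , c)
  with cherry-picked-or-kept _≟_ ps (phylo⇒distinct t (phylo t∈T)) (IsTreeChildSeq.reduces seq t∈T) c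
... | inj₁ picked = picked
... | inj₂ ()
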